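{- Let $a$ and $k$ be two coprime integers greater than $1$ and let $r\in\{1,\dots,a-1\}$. Then $$\langle a+jk:\ j\in\{0,\dots,r\}\rangle=\frac{\langle a,\ a^2+(ar+1)k\rangle}{ar+1}.$$ Moreover, if $a$ and $r$ are coprime, then $$\langle a+jk:\ j\in\{0,\dots,r\}\rangle=\frac{\langle a,\ a+rk\rangle}{r}.$$
   Context: For a set $A$ of positive integers, $\langle A\rangle$ is the set of all finite $\mathbb{N}$-linear combinations of elements of $A$. For a numerical semigroup $S$ and a positive integer $d$, $S/d=\{x\in\mathbb{N}:dx\in S\}$. -}

module Defs where

open import Data.Nat using (ℕ; zero; suc; _+_; _*_)
open import Data.List using (List; map; upTo)
open import Data.List.Membership.Propositional using (_∈_)

-- ⟨ A ⟩ for a finite set A of positive integers (given as a list):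
-- the set of all finite ℕ-linear combinations of elements of A,
-- i.e. the closure of {0} under adding generators.
data ⟨_⟩ (A : List ℕ) : ℕ → Set where
  zero∈ : ⟨ A ⟩ 0
  add∈  : ∀ {g x} → g ∈ A → ⟨ A ⟩ x → ⟨ A ⟩ (g + x)

_/ₛ_ : (ℕ → Set) → ℕ → (ℕ → Set)
(S /ₛ d) x = S (d * x)

_≐_ : (ℕ → Set) → (ℕ → Set) → Set
S ≐ T = ∀ x → (S x → T x) × (T x → S x)
  where open import Data.Product using (_×_)

arith : ℕ → ℕ → ℕ → List ℕ
arith a k r = map (λ j → a + j * k) (upTo (suc r))

-- The monoid generated by a + j k (0 ≤ j ≤ r) is { n a + m k : 0 ≤ m ≤ r n }, the image of
-- the lattice points of a cone. Multiplying such an element by d = a r + 1 (resp. by r)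
-- lands in ⟨ a , b ⟩ for b = a² + d k (resp. b = a + r k). Conversely, if d x = u a + v b
-- then d divides u + v a (resp. r divides u + v) since d (resp. r) is coprime to a; with
-- quotient t this gives x = t a + v k. When v overshoots r t, the surplus is moved back into
-- the cone by trading a copies of k for k copies of a.
module Submission where

open import Defs
open import Data.Nat using (ℕ; suc; zero; _+_; _*_; _<_; _≤_; z≤n; s≤s; NonZero; >-nonZero)
open import Data.Nat.Properties
open import Data.Nat.GCD using (gcd)
open import Data.Nat.Divisibility using (_∣_; divides; ∣m+n∣m⇒∣n; ∣1⇒≡1; ∣m⇒∣m*n; m∣m*n)
open import Data.Nat.Coprimality using (Coprime; gcd≡1⇒coprime; coprime-divisor)
  renaming (sym to coprime-sym)
open import Data.Nat.Tactic.RingSolver using (solve-∀)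
open import Data.List using (_∷_; []; upTo)
open import Data.List.Membership.Propositional using (_∈_)
open import Data.List.Membership.Propositional.Properties using (∈-upTo⁺; ∈-upTo⁻; ∈-map⁺; ∈-map⁻)
open import Data.List.Relation.Unary.Any using (here; there)
open import Data.Product using (_×_; _,_; ∃; ∃₂)
open import Data.Sum using (inj₁; inj₂)
open import Relation.Binary.PropositionalEquality

≐-trans : ∀ {S T U : ℕ → Set} → S ≐ T → T ≐ U → S ≐ U
≐-trans S≐T T≐U x with S≐T x | T≐U x
... | S⇒T , T⇒S | T⇒U , U⇒T = (λ s → T⇒U (S⇒T s)) , (λ u → T⇒S (U⇒T u))

≤-+-split : ∀ {m p q} → m ≤ p + q → ∃₂ λ i j → i ≤ p × j ≤ q × i + j ≡ m
≤-+-split {m} {p} {q} m≤p+q with ≤-total m p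
... | inj₁ m≤p = m , 0 , m≤p , z≤n , +-identityʳ m
... | inj₂ p≤m with m≤n⇒∃[o]m+o≡n p≤m
...   | j , p+j≡m = p , j , ≤-refl , +-cancelˡ-≤ p j q (subst (_≤ p + q) (sym p+j≡m) m≤p+q) , p+j≡m

coprime-*+1 : ∀ a r → Coprime (a * r + 1) a
coprime-*+1 a r (i∣ar+1 , i∣a) = ∣1⇒≡1 (∣m+n∣m⇒∣n i∣ar+1 (∣m⇒∣m*n r i∣a))

coprime-split : ∀ {d a c w} x .{{_ : NonZero d}} → Coprime d a →
                d * x ≡ a * c + d * w → ∃ λ t → c ≡ t * d × x ≡ t * a + w
coprime-split {d} {a} {c} {w} x d⊥a dx≡ac+dw
  with coprime-divisor d⊥a (∣m+n∣m⇒∣n d∣dw+ac (m∣m*n w))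
  where
  d∣dw+ac : d ∣ d * w + a * c
  d∣dw+ac = subst (d ∣_) (trans dx≡ac+dw (+-comm (a * c) (d * w))) (m∣m*n x)
... | divides t c≡t*d = t , c≡t*d , *-cancelˡ-≡ x (t * a + w) d (begin
  d * x               ≡⟨ dx≡ac+dw ⟩
  a * c + d * w       ≡⟨ cong (λ c → a * c + d * w) c≡t*d ⟩
  a * (t * d) + d * w ≡⟨ regroup a t d w ⟩
  d * (t * a + w)     ∎)
  where
  open ≡-Reasoning
  regroup : ∀ a t d w → a * (t * d) + d * w ≡ d * (t * a + w)
  regroup = solve-∀

∈⟨pair⟩⇒combination : ∀ {a b x} → ⟨ a ∷ b ∷ [] ⟩ x → ∃₂ λ u v → x ≡ u * a + v * b
∈⟨pair⟩⇒combination zero∈ = 0 , 0 , refl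
∈⟨pair⟩⇒combination {a} {b} (add∈ (here refl) p) with ∈⟨pair⟩⇒combination p
... | u , v , refl = suc u , v , sym (+-assoc a (u * a) (v * b))
∈⟨pair⟩⇒combination {a} {b} (add∈ (there (here refl)) p) with ∈⟨pair⟩⇒combination p
... | u , v , refl = u , suc v , x+[y+z]≡y+[x+z] b (u * a) (v * b)
  where
  x+[y+z]≡y+[x+z] : ∀ x y z → x + (y + z) ≡ y + (x + z)
  x+[y+z]≡y+[x+z] = solve-∀

combination∈⟨pair⟩ : ∀ a b u v → ⟨ a ∷ b ∷ [] ⟩ (u * a + v * b)
combination∈⟨pair⟩ a b zero    zero    = zero∈
combination∈⟨pair⟩ a b zero    (suc v) = add∈ (there (here refl)) (combination∈⟨pair⟩ a b zero v)
combination∈⟨pair⟩ a b (suc u) v       =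
  subst ⟨ a ∷ b ∷ [] ⟩ (sym (+-assoc a (u * a) (v * b))) (add∈ (here refl) (combination∈⟨pair⟩ a b u v))

Cone : ℕ → ℕ → ℕ → ℕ → Set
Cone a k r x = ∃₂ λ n m → m ≤ r * n × x ≡ n * a + m * k

∈arith⁻ : ∀ {a k r g} → g ∈ arith a k r → ∃ λ j → j ≤ r × g ≡ a + j * k
∈arith⁻ {a} {k} {r} g∈ with ∈-map⁻ (λ j → a + j * k) {xs = upTo (suc r)} g∈
... | j , j∈ , g≡a+jk with ∈-upTo⁻ j∈
...   | s≤s j≤r = j , j≤r , g≡a+jk

∈arith⁺ : ∀ {a k r j} → j ≤ r → a + j * k ∈ arith a k r
∈arith⁺ {a} {k} j≤r = ∈-map⁺ (λ j → a + j * k) (∈-upTo⁺ (s≤s j≤r))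

cone-step : ∀ a k j n m → a + j * k + (n * a + m * k) ≡ (1 + n) * a + (j + m) * k
cone-step = solve-∀

∈⟨arith⟩⇒Cone : ∀ {a k r x} → ⟨ arith a k r ⟩ x → Cone a k r x
∈⟨arith⟩⇒Cone zero∈ = 0 , 0 , z≤n , refl
∈⟨arith⟩⇒Cone {a} {k} {r} (add∈ g∈ p) with ∈arith⁻ g∈ | ∈⟨arith⟩⇒Cone p
... | j , j≤r , refl | n , m , m≤rn , refl =
  suc n , j + m , subst (j + m ≤_) (sym (*-suc r n)) (+-mono-≤ j≤r m≤rn) , cone-step a k j n m

cone-point∈⟨arith⟩ : ∀ {a k r} n m → m ≤ r * n → ⟨ arith a k r ⟩ (n * a + m * k)
cone-point∈⟨arith⟩ {r = r} zero m m≤r*0 with n≤0⇒n≡0 (subst (m ≤_) (*-zeroʳ r) m≤r*0)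
... | refl = zero∈
cone-point∈⟨arith⟩ {a} {k} {r} (suc n) m m≤r*[1+n] with ≤-+-split {p = r} {q = r * n} (subst (m ≤_) (*-suc r n) m≤r*[1+n])
... | j , m′ , j≤r , m′≤rn , refl =
  subst ⟨ arith a k r ⟩ (cone-step a k j n m′) (add∈ (∈arith⁺ j≤r) (cone-point∈⟨arith⟩ n m′ m′≤rn))

⟨arith⟩≐Cone : ∀ a k r → ⟨ arith a k r ⟩ ≐ Cone a k r
⟨arith⟩≐Cone a k r x = ∈⟨arith⟩⇒Cone , λ { (n , m , m≤rn , refl) → cone-point∈⟨arith⟩ n m m≤rn }

overshoot-bound : ∀ a r t s → (r * t + s) * a ≤ (a * r + 1) * t → s * a ≤ t
overshoot-bound a r t s le = +-cancelˡ-≤ (a * (r * t)) (s * a) t (subst₂ _≤_ (expand₁ a r t s) (expand₂ a r t) le)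
  where
  expand₁ : ∀ a r t s → (r * t + s) * a ≡ a * (r * t) + s * a
  expand₁ = solve-∀
  expand₂ : ∀ a r t → (a * r + 1) * t ≡ a * (r * t) + t
  expand₂ = solve-∀

-- Writing v = r t + s and r t = s a + c, trade s a copies of k for s k copies of a.
cone-overshoot : ∀ {a k r} t v .{{_ : NonZero a}} .{{_ : NonZero r}} →
                 v * a ≤ (a * r + 1) * t → Cone a k r (t * a + v * k)
cone-overshoot {a} {k} {r} t v va≤dt with ≤-total v (r * t)
... | inj₁ v≤rt = t , v , v≤rt , refl
... | inj₂ rt≤v with m≤n⇒∃[o]m+o≡n rt≤v
...   | s , refl with m≤n⇒∃[o]m+o≡n (≤-trans (overshoot-bound a r t s va≤dt) (m≤n*m t r))
...     | c , sa+c≡rt = t + s * k , c + s , bound , identity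
  where
  bound : c + s ≤ r * (t + s * k)
  bound = begin
    c + s           ≤⟨ +-monoʳ-≤ c (m≤m*n s a) ⟩
    c + s * a       ≡⟨ +-comm c (s * a) ⟩
    s * a + c       ≡⟨ sa+c≡rt ⟩
    r * t           ≤⟨ *-monoʳ-≤ r (m≤m+n t (s * k)) ⟩
    r * (t + s * k) ∎
    where open ≤-Reasoning
  trade : ∀ a k t s c → t * a + (s * a + c + s) * k ≡ (t + s * k) * a + (c + s) * k
  trade = solve-∀
  identity : t * a + (r * t + s) * k ≡ (t + s * k) * a + (c + s) * k
  identity = trans (cong (λ z → t * a + (z + s) * k) (sym sa+c≡rt)) (trade a k t s c)

Cone≐⟨a,a²+dk⟩/d : ∀ a k r .{{_ : NonZero a}} .{{_ : NonZero r}} →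
                   Cone a k r ≐ (⟨ a ∷ (a * a + (a * r + 1) * k) ∷ [] ⟩ /ₛ (a * r + 1))
Cone≐⟨a,a²+dk⟩/d a k r x = into , outof
  where
  d = a * r + 1
  b = a * a + d * k
  instance
    d-nonZero : NonZero d
    d-nonZero = >-nonZero (m≤n+m 1 (a * r))
  into : Cone a k r x → ⟨ a ∷ b ∷ [] ⟩ (d * x)
  into (n , m , m≤rn , refl) with m≤n⇒∃[o]m+o≡n m≤rn
  ... | e , m+e≡rn = subst ⟨ a ∷ b ∷ [] ⟩ (begin
    (a * e + n) * a + m * b                 ≡⟨ expand₁ a k r n m e ⟩
    a * a * (m + e) + n * a + m * (d * k)   ≡⟨ cong (λ z → a * a * z + n * a + m * (d * k)) m+e≡rn ⟩
    a * a * (r * n) + n * a + m * (d * k)   ≡⟨ expand₂ a k r n m ⟩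
    d * (n * a + m * k)                     ∎) (combination∈⟨pair⟩ a b (a * e + n) m)
    where
    open ≡-Reasoning
    expand₁ : ∀ a k r n m e → (a * e + n) * a + m * (a * a + (a * r + 1) * k)
                              ≡ a * a * (m + e) + n * a + m * ((a * r + 1) * k)
    expand₁ = solve-∀
    expand₂ : ∀ a k r n m → a * a * (r * n) + n * a + m * ((a * r + 1) * k)
                            ≡ (a * r + 1) * (n * a + m * k)
    expand₂ = solve-∀
  regroup : ∀ a k r u v → u * a + v * (a * a + (a * r + 1) * k) ≡ a * (u + v * a) + (a * r + 1) * (v * k)
  regroup = solve-∀
  outof : ⟨ a ∷ b ∷ [] ⟩ (d * x) → Cone a k r x
  outof dx∈ =
    let u , v , dx≡ua+vb       = ∈⟨pair⟩⇒combination dx∈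
        t , u+va≡td , x≡ta+vk  = coprime-split x (coprime-*+1 a r) (trans dx≡ua+vb (regroup a k r u v))
        va≤dt : v * a ≤ d * t
        va≤dt                  = subst (v * a ≤_) (trans u+va≡td (*-comm t d)) (m≤n+m (v * a) u)
    in subst (Cone a k r) (sym x≡ta+vk) (cone-overshoot t v va≤dt)

Cone≐⟨a,a+rk⟩/r : ∀ a k r .{{_ : NonZero r}} → Coprime r a →
                  Cone a k r ≐ (⟨ a ∷ (a + r * k) ∷ [] ⟩ /ₛ r)
Cone≐⟨a,a+rk⟩/r a k r r⊥a x = into , outof
  where
  b = a + r * k
  into : Cone a k r x → ⟨ a ∷ b ∷ [] ⟩ (r * x)
  into (n , m , m≤rn , refl) with m≤n⇒∃[o]m+o≡n m≤rn
  ... | e , m+e≡rn = subst ⟨ a ∷ b ∷ [] ⟩ (begin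
    e * a + m * b             ≡⟨ expand₁ a k r m e ⟩
    (m + e) * a + m * (r * k) ≡⟨ cong (λ z → z * a + m * (r * k)) m+e≡rn ⟩
    r * n * a + m * (r * k)   ≡⟨ expand₂ a k r n m ⟩
    r * (n * a + m * k)       ∎) (combination∈⟨pair⟩ a b e m)
    where
    open ≡-Reasoning
    expand₁ : ∀ a k r m e → e * a + m * (a + r * k) ≡ (m + e) * a + m * (r * k)
    expand₁ = solve-∀
    expand₂ : ∀ a k r n m → r * n * a + m * (r * k) ≡ r * (n * a + m * k)
    expand₂ = solve-∀
  regroup : ∀ a k r u v → u * a + v * (a + r * k) ≡ a * (u + v) + r * (v * k)
  regroup = solve-∀
  outof : ⟨ a ∷ b ∷ [] ⟩ (r * x) → Cone a k r x
  outof rx∈ =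
    let u , v , rx≡ua+vb      = ∈⟨pair⟩⇒combination rx∈
        t , u+v≡tr , x≡ta+vk  = coprime-split x r⊥a (trans rx≡ua+vb (regroup a k r u v))
    in t , v , subst (v ≤_) (trans u+v≡tr (*-comm t r)) (m≤n+m v u) , x≡ta+vk

-- Only a ≥ 1 and r ≥ 1 (and gcd a r ≡ 1 for the second part) are needed.
corollary1 : ∀ (a k r : ℕ) → 1 < a → 1 < k → gcd a k ≡ 1 → 1 ≤ r → r < a →
    (⟨ arith a k r ⟩ ≐ (⟨ a ∷ (a * a + (a * r + 1) * k) ∷ [] ⟩ /ₛ (a * r + 1)))
    × (gcd a r ≡ 1 → ⟨ arith a k r ⟩ ≐ (⟨ a ∷ (a + r * k) ∷ [] ⟩ /ₛ r))
corollary1 a@(suc _) k r@(suc _) _ _ _ _ _ =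
  ≐-trans (⟨arith⟩≐Cone a k r) (Cone≐⟨a,a²+dk⟩/d a k r) ,
  λ gcd[a,r]≡1 → ≐-trans (⟨arith⟩≐Cone a k r)
                         (Cone≐⟨a,a+rk⟩/r a k r (coprime-sym (gcd≡1⇒coprime gcd[a,r]≡1)))
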